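{- Let $G=(V,E)$ be a finite simple connected graph and $q\in V$. Then $|\mathcal{P}(G,q)|=1$ if and only if $|\mathrm{MP}(G,q)|=1$.
   Context: For $A\subseteq V$ and $v\in A$, $d_{\overline{A}}(v)$ denotes the number of edges $vw$ with $w\notin A$. A $G$-parking function with respect to $q$ is a function $f:V\to\mathbb{Z}_{\geq -1}$ with $f(q)=-1$ such that for every non-empty $A\subseteq V\setminus\{q\}$ there exists $v\in A$ with $0\leq f(v)<d_{\overline{A}}(v)$. $\mathcal{P}(G,q)$ is the set of all $G$-parking functions with respect to $q$, and $\mathrm{MP}(G,q)$ is the set of maximum ones, i.e. those maximizing $\sum_{v\in V}f(v)$. -}

module Defs where

open import Data.Nat using (ℕ; zero; suc)
open import Data.Fin using (Fin)
open import Data.Fin.Subset using (Subset; _∈_; _∉_; Nonempty)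
open import Data.Bool using (Bool; true; false; T)
open import Data.List using (List; []; _∷_; foldr; map; filter; length; allFin)
open import Data.Integer as ℤ using (ℤ; +_; -[1+_]; 0ℤ; _≤_; _<_)
open import Data.Product using (Σ; ∃; _×_; _,_)
open import Relation.Binary.PropositionalEquality using (_≡_; _≢_)
open import Relation.Nullary using (¬_)
open import Data.Fin.Subset.Properties using (_∈?_)
open import Relation.Nullary.Decidable using (¬?)

record Graph (n : ℕ) : Set where
  field
    adj   : Fin n → Fin n → Bool
    sym   : ∀ u v → adj u v ≡ adj v u
    irrefl : ∀ v → adj v v ≡ false
open Graph public

data Reach {n : ℕ} (G : Graph n) : Fin n → Fin n → Set where
  here : ∀ {v} → Reach G v v
  step : ∀ {u v w} → T (adj G u v) → Reach G v w → Reach G u w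

Connected : ∀ {n} → Graph n → Set
Connected G = ∀ u v → Reach G u v

dOut : ∀ {n} → Graph n → Subset n → Fin n → ℕ
dOut {n} G A v = length (filter (λ w → ¬? (w ∈? A)) (filter (λ w → T? (adj G v w)) (allFin n)))
  where
  open import Data.Bool.Properties using (T?)

IsParking : ∀ {n} → Graph n → Fin n → (Fin n → ℤ) → Set
IsParking G q f =
  (∀ v → -[1+ 0 ] ≤ f v) ×
  (f q ≡ -[1+ 0 ]) ×
  (∀ (A : Subset _) → q ∉ A → Nonempty A →
     ∃ λ v → v ∈ A × 0ℤ ≤ f v × f v < + dOut G A v)

total : ∀ {n} → (Fin n → ℤ) → ℤ
total {n} f = foldr ℤ._+_ 0ℤ (map f (allFin n))

IsMaxParking : ∀ {n} → Graph n → Fin n → (Fin n → ℤ) → Set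
IsMaxParking G q f = IsParking G q f × (∀ g → IsParking G q g → total g ≤ total f)

ExactlyOne : ∀ {n} → ((Fin n → ℤ) → Set) → Set
ExactlyOne {n} P = ∃ λ f → P f × (∀ g → P g → ∀ v → g v ≡ f v)

-- A parking function is nonnegative off q. Hence a maximum parking function f that is
-- nonpositive off q lies pointwise below every parking function, each of which is then
-- maximum too, so f is the only parking function. Conversely, let f be maximum with
-- f v > 0 for some v ≠ q. Order the vertices as Dhar's burning algorithm burns them and
-- move v just before its latest earlier neighbour w: lowering f v and raising f w by one
-- gives another maximum parking function, so the maximum is not unique.
module Submission where

open import Defs hiding (sym)
open import Algebra.Properties.CommutativeSemigroup using (x∙yz≈y∙xz)
open import Data.Bool using (T)
open import Data.Bool.Properties using (T?)
open import Data.Fin using (Fin; zero; suc; toℕ)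
open import Data.Fin.Properties using (_≟_; toℕ-injective)
open import Data.Fin.Subset as Subset using (Subset; ⁅_⁆; ∁; _-_; ∣_∣)
open import Data.Fin.Subset.Properties
  using (_∈?_; nonempty?; ∣p∣≤n; x∈p⇒∣p-x∣<∣p∣; x∈p∧x≢y⇒x∈p-y; p─q⊆p;
         x∈⁅x⁆; x∈⁅y⁆⇒x≡y; x≢y⇒x∉⁅y⁆; x∈∁p⇒x∉p; x∉p⇒x∈∁p; x∉∁p⇒x∈p)
open import Data.Integer as ℤ using (ℤ; +_; -[1+_]; 0ℤ; +≤+; +<+; -≤+)
import Data.Integer.Properties as ℤ
open import Data.List using (List; []; _∷_; filter; length; allFin; foldr)
import Data.List.Properties as List
open import Data.List.Extrema.Nat
  using (argmin; argmin-all; f[argmin]≤f[xs]; argmax; argmax-sel; f[xs]≤f[argmax])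
open import Data.List.Membership.Propositional using (_∈_)
open import Data.List.Membership.Propositional.Properties using (∈-filter⁺; ∈-filter⁻; ∈-allFin)
open import Data.List.Relation.Unary.All as All using (All; []; _∷_; lookup)
open import Data.List.Relation.Unary.All.Properties using (all-filter)
open import Data.List.Relation.Unary.AllPairs using (_∷_)
open import Data.List.Relation.Unary.Any using (here; there)
open import Data.List.Relation.Unary.Unique.Propositional using (Unique)
import Data.List.Relation.Unary.Unique.Propositional.Properties as Unique
open import Data.Nat as ℕ using (ℕ; zero; suc; z≤n; s≤s)
import Data.Nat.Properties as ℕ
open import Data.Product using (∃; _×_; _,_; proj₁; proj₂)
open import Data.Sum using (_⊎_; inj₁; inj₂)
open import Data.Vec.Functional using (updateAt)
open import Data.Vec.Functional.Properties using (updateAt-updates; updateAt-minimal)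
open import Function using (_∘_; id)
open import Function.Bundles using (_⇔_; mk⇔)
open import Function.Definitions using (Injective)
open import Relation.Binary.PropositionalEquality
open import Relation.Nullary using (¬_; Dec; yes; no; contradiction)
open import Relation.Nullary.Decidable using (¬?)
open import Relation.Unary using (Pred; Decidable)
open import Relation.Unary.Properties using (_∪?_)

module _ {a p q} {A : Set a} {P : Pred A p} {Q : Pred A q} (P? : Decidable P) (Q? : Decidable Q) where

  length-filter-mono : ∀ xs → (∀ {x} → x ∈ xs → P x → Q x) →
                       length (filter P? xs) ℕ.≤ length (filter Q? xs)
  length-filter-mono []       P⇒Q = z≤n
  length-filter-mono (x ∷ xs) P⇒Q with P? x | Q? x
  ... | yes px | no ¬qx = contradiction (P⇒Q (here refl) px) ¬qx
  ... | yes _  | yes _  = s≤s (length-filter-mono xs (P⇒Q ∘ there))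
  ... | no _   | yes _  = ℕ.m≤n⇒m≤1+n (length-filter-mono xs (P⇒Q ∘ there))
  ... | no _   | no _   = length-filter-mono xs (P⇒Q ∘ there)

  length-filter-mono-< : ∀ xs {z} → (∀ {x} → x ∈ xs → P x → Q x) → z ∈ xs → Q z → ¬ P z →
                         length (filter P? xs) ℕ.< length (filter Q? xs)
  length-filter-mono-< (x ∷ xs) P⇒Q (here refl) qz ¬pz with P? x | Q? x
  ... | yes px | _     = contradiction px ¬pz
  ... | no _   | no ¬q = contradiction qz ¬q
  ... | no _   | yes _ = s≤s (length-filter-mono xs (P⇒Q ∘ there))
  length-filter-mono-< (x ∷ xs) P⇒Q (there z∈xs) qz ¬pz with P? x | Q? x
  ... | yes px | no ¬qx = contradiction (P⇒Q (here refl) px) ¬qx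
  ... | yes _  | yes _  = s≤s (length-filter-mono-< xs (P⇒Q ∘ there) z∈xs qz ¬pz)
  ... | no _   | yes _  = ℕ.m≤n⇒m≤1+n (length-filter-mono-< xs (P⇒Q ∘ there) z∈xs qz ¬pz)
  ... | no _   | no _   = length-filter-mono-< xs (P⇒Q ∘ there) z∈xs qz ¬pz

  length-filter-∪ : ∀ xs → length (filter (P? ∪? Q?) xs) ℕ.≤ length (filter P? xs) ℕ.+ length (filter Q? xs)
  length-filter-∪ []       = z≤n
  length-filter-∪ (x ∷ xs) with P? x | Q? x
  ... | yes _ | yes _ = s≤s (ℕ.≤-trans (length-filter-∪ xs) (ℕ.+-monoʳ-≤ _ (ℕ.n≤1+n _)))
  ... | yes _ | no _  = s≤s (length-filter-∪ xs)
  ... | no _  | yes _ = ℕ.≤-trans (s≤s (length-filter-∪ xs)) (ℕ.≤-reflexive (sym (ℕ.+-suc _ _)))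
  ... | no _  | no _  = length-filter-∪ xs

unique-constant⇒length≤1 : ∀ {a} {A : Set a} {w : A} {xs} → Unique xs → All (_≡ w) xs → length xs ℕ.≤ 1
unique-constant⇒length≤1 {xs = []}         _               _                = z≤n
unique-constant⇒length≤1 {xs = _ ∷ []}     _               _                = s≤s z≤n
unique-constant⇒length≤1 {xs = _ ∷ _ ∷ _} ((x≢y ∷ _) ∷ _) (x≡w ∷ y≡w ∷ _) =
  contradiction (trans x≡w (sym y≡w)) x≢y

total-suc : ∀ {n} (f : Fin (suc n) → ℤ) → total f ≡ f zero ℤ.+ total (f ∘ suc)
total-suc f = cong (λ xs → f zero ℤ.+ foldr ℤ._+_ 0ℤ xs)
  (trans (List.map-tabulate suc f) (sym (List.map-tabulate id (f ∘ suc))))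

total-mono : ∀ {n} {f g : Fin n → ℤ} → (∀ x → f x ℤ.≤ g x) → total f ℤ.≤ total g
total-mono {zero}          f≤g = ℤ.≤-refl
total-mono {suc n} {f} {g} f≤g = begin
  total f                     ≡⟨ total-suc f ⟩
  f zero ℤ.+ total (f ∘ suc)  ≤⟨ ℤ.+-mono-≤ (f≤g zero) (total-mono (f≤g ∘ suc)) ⟩
  g zero ℤ.+ total (g ∘ suc)  ≡⟨ total-suc g ⟨
  total g                     ∎
  where open ℤ.≤-Reasoning

total-updateAt-+ : ∀ {n} (f : Fin n → ℤ) i c → total (updateAt f i (ℤ._+_ c)) ≡ c ℤ.+ total f
total-updateAt-+ {suc n} f zero c = begin
  total (updateAt f zero (ℤ._+_ c))   ≡⟨ total-suc (updateAt f zero (ℤ._+_ c)) ⟩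
  (c ℤ.+ f zero) ℤ.+ total (f ∘ suc)  ≡⟨ ℤ.+-assoc c _ _ ⟩
  c ℤ.+ (f zero ℤ.+ total (f ∘ suc))  ≡⟨ cong (ℤ._+_ c) (total-suc f) ⟨
  c ℤ.+ total f                       ∎
  where open ≡-Reasoning
total-updateAt-+ {suc n} f (suc i) c = begin
  total (updateAt f (suc i) (ℤ._+_ c))               ≡⟨ total-suc (updateAt f (suc i) (ℤ._+_ c)) ⟩
  f zero ℤ.+ total (updateAt (f ∘ suc) i (ℤ._+_ c))  ≡⟨ cong (ℤ._+_ (f zero)) (total-updateAt-+ (f ∘ suc) i c) ⟩
  f zero ℤ.+ (c ℤ.+ total (f ∘ suc))                 ≡⟨ x∙yz≈y∙xz ℤ.+-commutativeSemigroup (f zero) c _ ⟩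
  c ℤ.+ (f zero ℤ.+ total (f ∘ suc))                 ≡⟨ cong (ℤ._+_ c) (total-suc f) ⟨
  c ℤ.+ total f                                      ∎
  where open ≡-Reasoning

-- Vertex orders, as injective rankings in ℕ

module _ {n : ℕ} where

  below? : (r : Fin n → ℕ) (v : Fin n) → Decidable (λ u → r u ℕ.< r v)
  below? r v u = r u ℕ.<? r v

  outside? : (U : Subset n) → Decidable (Subset._∉ U)
  outside? U u = ¬? (u ∈? U)

  prepend : Fin n → (Fin n → ℕ) → Fin n → ℕ
  prepend a r x with x ≟ a
  ... | yes _ = 0
  ... | no _  = suc (r x)

  prepend-< : ∀ a r {x y} → x ≢ a → y ≡ a ⊎ r y ℕ.< r x → prepend a r y ℕ.< prepend a r x
  prepend-< a r {x} {y} x≢a y<x with x ≟ a | y ≟ a | y<x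
  ... | yes x≡a | _      | _        = contradiction x≡a x≢a
  ... | no _    | yes _  | _        = s≤s z≤n
  ... | no _    | no y≢a | inj₁ y≡a = contradiction y≡a y≢a
  ... | no _    | no _   | inj₂ lt  = s≤s lt

  prepend-injective : ∀ a {r} → Injective _≡_ _≡_ r → Injective _≡_ _≡_ (prepend a r)
  prepend-injective a {r} r-inj {x} {y} eq with x ≟ a | y ≟ a
  ... | yes x≡a | yes y≡a = trans x≡a (sym y≡a)
  ... | no _    | no _    = r-inj (ℕ.suc-injective eq)
  ... | yes _   | no _    = contradiction eq λ ()
  ... | no _    | yes _   = contradiction eq λ ()

  -- Doubling the ranks leaves room to place v immediately before w.
  moveBefore : Fin n → Fin n → (Fin n → ℕ) → Fin n → ℕ
  moveBefore v w r x with x ≟ v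
  ... | yes _ = suc (r w ℕ.+ r w)
  ... | no _  = suc (suc (r x ℕ.+ r x))

  module _ (v w : Fin n) (r : Fin n → ℕ) where

    moveBefore-< : ∀ {x y} → x ≢ v → r y ℕ.< r x → (y ≡ v → r w ℕ.≤ r x) →
                   moveBefore v w r y ℕ.< moveBefore v w r x
    moveBefore-< {x} {y} x≢v ry<rx rw≤rx with x ≟ v | y ≟ v
    ... | yes x≡v | _       = contradiction x≡v x≢v
    ... | no _    | yes y≡v = s≤s (s≤s (ℕ.+-mono-≤ (rw≤rx y≡v) (rw≤rx y≡v)))
    ... | no _    | no _    = s≤s (s≤s (ℕ.+-mono-< ry<rx ry<rx))

    moveBefore-moved : ∀ {x} → x ≢ v → r w ℕ.≤ r x → moveBefore v w r v ℕ.< moveBefore v w r x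
    moveBefore-moved {x} x≢v rw≤rx with x ≟ v | v ≟ v
    ... | yes x≡v | _      = contradiction x≡v x≢v
    ... | _       | no v≢v = contradiction refl v≢v
    ... | no _    | yes _  = s≤s (s≤s (ℕ.+-mono-≤ rw≤rx rw≤rx))

    moveBefore-before : ∀ {y} → y ≢ v → r y ℕ.< r w → moveBefore v w r y ℕ.< moveBefore v w r v
    moveBefore-before {y} y≢v ry<rw with y ≟ v | v ≟ v
    ... | yes y≡v | _      = contradiction y≡v y≢v
    ... | _       | no v≢v = contradiction refl v≢v
    ... | no _    | yes _  =
      s≤s (subst (ℕ._≤ r w ℕ.+ r w) (ℕ.+-suc (suc (r y)) (r y)) (ℕ.+-mono-≤ ry<rw ry<rw))

module _ {n : ℕ} (G : Graph n) (q : Fin n) where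

  neighbours : Fin n → List (Fin n)
  neighbours v = filter (λ w → T? (adj G v w)) (allFin n)

  neighbours-unique : ∀ v → Unique (neighbours v)
  neighbours-unique v = Unique.filter⁺ (λ w → T? (adj G v w)) (Unique.allFin⁺ n)

  neighbours-sym : ∀ {v w} → w ∈ neighbours v → v ∈ neighbours w
  neighbours-sym {v} {w} w∈ = ∈-filter⁺ (λ u → T? (adj G w u)) (∈-allFin v)
    (subst T (Graph.sym G v w) (proj₂ (∈-filter⁻ (λ u → T? (adj G v u)) {xs = allFin n} w∈)))

  earlier : (Fin n → ℕ) → Fin n → List (Fin n)
  earlier r v = filter (below? r v) (neighbours v)

  -- r ranks the vertices in an order in which Dhar's burning algorithm, started at q, burns them.
  BurningOrder : (Fin n → ℤ) → (Fin n → ℕ) → Set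
  BurningOrder f r = ∀ x → x ≢ q → f x ℤ.< + length (earlier r x)

  parking-nonneg : ∀ {f} → IsParking G q f → ∀ x → x ≢ q → 0ℤ ℤ.≤ f x
  parking-nonneg {f} (_ , _ , parking) x x≢q with parking ⁅ x ⁆ (x≢y⇒x∉⁅y⁆ (x≢q ∘ sym)) (x , x∈⁅x⁆ x)
  ... | y , y∈⁅x⁆ , 0≤fy , _ = subst (λ z → 0ℤ ℤ.≤ f z) (x∈⁅y⁆⇒x≡y x y∈⁅x⁆) 0≤fy

  burningOrder⇒parking : ∀ {f r} → f q ≡ -[1+ 0 ] → (∀ x → x ≢ q → 0ℤ ℤ.≤ f x) →
                         BurningOrder f r → IsParking G q f
  burningOrder⇒parking {f} {r} fq≡-1 nonneg burns = lower-bound , fq≡-1 , parking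
    where
    lower-bound : ∀ x → -[1+ 0 ] ℤ.≤ f x
    lower-bound x with x ≟ q
    ... | yes refl = ℤ.≤-reflexive (sym fq≡-1)
    ... | no x≢q   = ℤ.≤-trans -≤+ (nonneg x x≢q)

    -- The first vertex of A in the order only has earlier neighbours outside A.
    parking : ∀ A → q Subset.∉ A → Subset.Nonempty A →
              ∃ λ v → v Subset.∈ A × 0ℤ ℤ.≤ f v × f v ℤ.< + dOut G A v
    parking A q∉A (a , a∈A) = m , m∈A , nonneg m m≢q ,
      ℤ.<-≤-trans (burns m m≢q)
        (+≤+ (length-filter-mono (below? r m) (outside? A) (neighbours m) earlier⇒outside))
      where
      inA : List (Fin n)
      inA = filter (_∈? A) (allFin n)
      m : Fin n
      m = argmin r a inA
      m∈A : m Subset.∈ A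
      m∈A = argmin-all r a∈A (all-filter (_∈? A) (allFin n))
      m≢q : m ≢ q
      m≢q m≡q = q∉A (subst (Subset._∈ A) m≡q m∈A)
      earlier⇒outside : ∀ {y} → y ∈ neighbours m → r y ℕ.< r m → y Subset.∉ A
      earlier⇒outside {y} _ ry<rm y∈A =
        ℕ.<⇒≱ ry<rm (lookup (f[argmin]≤f[xs] a inA) (∈-filter⁺ (_∈? A) (∈-allFin y) y∈A))

  burntBefore : Subset n → (Fin n → ℕ) → Fin n → List (Fin n)
  burntBefore U r v = filter (outside? U ∪? below? r v) (neighbours v)

  BurningOrderOn : Subset n → (Fin n → ℤ) → (Fin n → ℕ) → Set
  BurningOrderOn U f r = ∀ v → v Subset.∈ U → f v ℤ.< + length (burntBefore U r v)

  ∉-remove : ∀ {U : Subset n} {u v} → u Subset.∉ U - v → u Subset.∉ U ⊎ u ≡ v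
  ∉-remove {U} {u} {v} u∉U-v with u ∈? U | u ≟ v
  ... | no u∉U  | _       = inj₁ u∉U
  ... | yes _   | yes u≡v = inj₂ u≡v
  ... | yes u∈U | no u≢v  = contradiction (x∈p∧x≢y⇒x∈p-y u∈U u≢v) u∉U-v

  -- The parking condition for U provides a vertex v₀ of U that burns first; U - v₀ is ordered recursively.
  burningOrderOn : ∀ {f} → IsParking G q f → ∀ k (U : Subset n) → ∣ U ∣ ℕ.≤ k → q Subset.∉ U →
                   ∃ λ r → Injective _≡_ _≡_ r × BurningOrderOn U f r
  burningOrderOn {f} P@(_ , _ , parking) k U |U|≤k q∉U with nonempty? U
  ... | no U-empty = toℕ , toℕ-injective , λ v v∈U → contradiction (v , v∈U) U-empty
  ... | yes U-nonempty with parking U q∉U U-nonempty | k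
  ... | v₀ , v₀∈U , _ , _ | zero = contradiction (ℕ.≤-trans (x∈p⇒∣p-x∣<∣p∣ v₀∈U) |U|≤k) λ ()
  ... | v₀ , v₀∈U , _ , fv₀<d | suc k
      with burningOrderOn P k (U - v₀) (ℕ.≤-pred (ℕ.≤-trans (x∈p⇒∣p-x∣<∣p∣ v₀∈U) |U|≤k))
                          (q∉U ∘ p─q⊆p U ⁅ v₀ ⁆)
  ... | r , r-inj , burns = r′ , prepend-injective v₀ r-inj , burns′
    where
    r′ : Fin n → ℕ
    r′ = prepend v₀ r

    burns′ : BurningOrderOn U f r′
    burns′ v v∈U = by-cases (v ≟ v₀)
      where
      by-cases : Dec (v ≡ v₀) → f v ℤ.< + length (burntBefore U r′ v)
      by-cases (yes v≡v₀) = ℤ.<-≤-trans (subst (λ x → f x ℤ.< + dOut G U x) (sym v≡v₀) fv₀<d)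
        (+≤+ (length-filter-mono (outside? U) (outside? U ∪? below? r′ v) (neighbours v) (λ _ → inj₁)))
      by-cases (no v≢v₀) = ℤ.<-≤-trans (burns v (x∈p∧x≢y⇒x∈p-y v∈U v≢v₀))
        (+≤+ (length-filter-mono (outside? (U - v₀) ∪? below? r v) (outside? U ∪? below? r′ v)
                                 (neighbours v) (λ _ → still-burnt)))
        where
        still-burnt : ∀ {u} → u Subset.∉ U - v₀ ⊎ r u ℕ.< r v → u Subset.∉ U ⊎ r′ u ℕ.< r′ v
        still-burnt (inj₂ ru<rv) = inj₂ (prepend-< v₀ r v≢v₀ (inj₂ ru<rv))
        still-burnt (inj₁ u∉U-v₀) with ∉-remove u∉U-v₀
        ... | inj₁ u∉U  = inj₁ u∉U
        ... | inj₂ u≡v₀ = inj₂ (prepend-< v₀ r v≢v₀ (inj₁ u≡v₀))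

  parking⇒burningOrder : ∀ {f} → IsParking G q f →
    ∃ λ r → Injective _≡_ _≡_ r × (∀ x → x ≢ q → r q ℕ.< r x) × BurningOrder f r
  parking⇒burningOrder {f} P with burningOrderOn P n (∁ ⁅ q ⁆) (∣p∣≤n (∁ ⁅ q ⁆)) (λ q∈ → x∈∁p⇒x∉p q∈ (x∈⁅x⁆ q))
  ... | r , r-inj , burns = r′ , prepend-injective q r-inj , (λ x x≢q → prepend-< q r x≢q (inj₁ refl)) , burns′
    where
    r′ : Fin n → ℕ
    r′ = prepend q r

    burnt-after-q : ∀ {x u} → x ≢ q → u Subset.∉ ∁ ⁅ q ⁆ ⊎ r u ℕ.< r x → r′ u ℕ.< r′ x
    burnt-after-q x≢q (inj₁ u∉) = prepend-< q r x≢q (inj₁ (x∈⁅y⁆⇒x≡y q (x∉∁p⇒x∈p u∉)))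
    burnt-after-q x≢q (inj₂ lt) = prepend-< q r x≢q (inj₂ lt)

    burns′ : BurningOrder f r′
    burns′ x x≢q = ℤ.<-≤-trans (burns x (x∉p⇒x∈∁p (x≢y⇒x∉⁅y⁆ x≢q)))
      (+≤+ (length-filter-mono (outside? (∁ ⁅ q ⁆) ∪? below? r x) (below? r′ x) (neighbours x)
                               (λ _ → burnt-after-q x≢q)))

  module Lowering {f r} (P : IsParking G q f) (r-inj : Injective _≡_ _≡_ r)
                  (q-first : ∀ x → x ≢ q → r q ℕ.< r x) (burns : BurningOrder f r)
                  {v k} (v≢q : v ≢ q) (fv≡1+k : f v ≡ + suc k) where

    many-earlier : 2 ℕ.+ k ℕ.≤ length (earlier r v)
    many-earlier = ℤ.drop‿+<+ (subst (ℤ._< + length (earlier r v)) fv≡1+k (burns v v≢q))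

    w : Fin n
    w = argmax r q (earlier r v)

    w-latest : ∀ {y} → y ∈ earlier r v → r y ℕ.≤ r w
    w-latest = lookup (f[xs]≤f[argmax] q (earlier r v))

    -- Otherwise every earlier neighbour of v would be q, but v has at least two.
    w≢q : w ≢ q
    w≢q w≡q = contradiction (ℕ.≤-trans many-earlier at-most-one) λ { (s≤s ()) }
      where
      only-q : ∀ {y} → y ∈ earlier r v → y ≡ q
      only-q {y} y∈ with y ≟ q
      ... | yes y≡q = y≡q
      ... | no y≢q  = contradiction (subst (λ z → r y ℕ.≤ r z) w≡q (w-latest y∈)) (ℕ.<⇒≱ (q-first y y≢q))
      at-most-one : length (earlier r v) ℕ.≤ 1
      at-most-one = unique-constant⇒length≤1 (Unique.filter⁺ (below? r v) (neighbours-unique v))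
                                             (All.tabulate only-q)

    w∈earlier : w ∈ earlier r v
    w∈earlier with argmax-sel r q (earlier r v)
    ... | inj₁ w≡q = contradiction w≡q w≢q
    ... | inj₂ w∈  = w∈

    w-neighbour : w ∈ neighbours v
    w-neighbour = proj₁ (∈-filter⁻ (below? r v) {xs = neighbours v} w∈earlier)

    rw<rv : r w ℕ.< r v
    rw<rv = proj₂ (∈-filter⁻ (below? r v) {xs = neighbours v} w∈earlier)

    w≢v : w ≢ v
    w≢v w≡v = ℕ.<-irrefl (cong r w≡v) rw<rv

    r′ : Fin n → ℕ
    r′ = moveBefore v w r

    f′ : Fin n → ℤ
    f′ = updateAt (updateAt f v ℤ.pred) w ℤ.suc

    f′-v : f′ v ≡ + k
    f′-v = trans (updateAt-minimal v w (updateAt f v ℤ.pred) (w≢v ∘ sym))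
                 (trans (updateAt-updates v f) (cong ℤ.pred fv≡1+k))

    f′-w : f′ w ≡ ℤ.suc (f w)
    f′-w = trans (updateAt-updates w (updateAt f v ℤ.pred)) (cong ℤ.suc (updateAt-minimal w v f w≢v))

    f′-other : ∀ {x} → x ≢ v → x ≢ w → f′ x ≡ f x
    f′-other {x} x≢v x≢w = trans (updateAt-minimal x w (updateAt f v ℤ.pred) x≢w) (updateAt-minimal x v f x≢v)

    total-f′ : total f′ ≡ total f
    total-f′ = begin
      total f′                             ≡⟨ total-updateAt-+ (updateAt f v ℤ.pred) w (+ 1) ⟩
      ℤ.suc (total (updateAt f v ℤ.pred))  ≡⟨ cong ℤ.suc (total-updateAt-+ f v -[1+ 0 ]) ⟩
      ℤ.suc (ℤ.pred (total f))             ≡⟨ ℤ.suc-pred (total f) ⟩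
      total f                              ∎
      where open ≡-Reasoning

    earlier-kept : ∀ {x y} → x ≢ v → r y ℕ.< r x → r′ y ℕ.< r′ x
    earlier-kept {x} x≢v ry<rx = moveBefore-< v w r x≢v ry<rx
      (λ y≡v → ℕ.<⇒≤ (ℕ.<-trans rw<rv (subst (λ z → r z ℕ.< r x) y≡v ry<rx)))

    earlier-at-v : ∀ {y} → y ∈ neighbours v → r y ℕ.< r v → y ≡ w ⊎ r′ y ℕ.< r′ v
    earlier-at-v {y} y∈ ry<rv with y ≟ w
    ... | yes y≡w = inj₁ y≡w
    ... | no y≢w  = inj₂ (moveBefore-before v w r (λ y≡v → ℕ.<-irrefl (cong r y≡v) ry<rv)
                           (ℕ.≤∧≢⇒< (w-latest (∈-filter⁺ (below? r v) y∈ ry<rv)) (y≢w ∘ r-inj)))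

    -- v loses the earlier neighbour w and nothing else.
    many-earlier′ : suc k ℕ.≤ length (earlier r′ v)
    many-earlier′ = ℕ.≤-pred (begin
      2 ℕ.+ k                                                          ≤⟨ many-earlier ⟩
      length (earlier r v)                                             ≤⟨ length-filter-mono (below? r v) w-or-earlier′
                                                                            (neighbours v) earlier-at-v ⟩
      length (filter w-or-earlier′ (neighbours v))                     ≤⟨ length-filter-∪ (_≟ w) (below? r′ v) (neighbours v) ⟩
      length (filter (_≟ w) (neighbours v)) ℕ.+ length (earlier r′ v)  ≤⟨ ℕ.+-monoˡ-≤ _ w-once ⟩
      1 ℕ.+ length (earlier r′ v)                                      ∎)
      where
      open ℕ.≤-Reasoning
      w-or-earlier′ : Decidable (λ y → y ≡ w ⊎ r′ y ℕ.< r′ v)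
      w-or-earlier′ = (_≟ w) ∪? below? r′ v
      w-once : length (filter (_≟ w) (neighbours v)) ℕ.≤ 1
      w-once = unique-constant⇒length≤1 (Unique.filter⁺ (_≟ w) (neighbours-unique v))
                                        (all-filter (_≟ w) (neighbours v))

    -- w gains the earlier neighbour v.
    more-earlier-w : length (earlier r w) ℕ.< length (earlier r′ w)
    more-earlier-w = length-filter-mono-< (below? r w) (below? r′ w) (neighbours w) (λ _ → earlier-kept w≢v)
      (neighbours-sym w-neighbour) (moveBefore-moved v w r w≢v ℕ.≤-refl) (ℕ.<⇒≯ rw<rv)

    burns-v : f′ v ℤ.< + length (earlier r′ v)
    burns-v = subst (ℤ._< + length (earlier r′ v)) (sym f′-v) (+<+ many-earlier′)

    burns-w : f′ w ℤ.< + length (earlier r′ w)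
    burns-w = subst (ℤ._< + length (earlier r′ w)) (sym f′-w)
      (ℤ.≤-<-trans (ℤ.i<j⇒suc[i]≤j (burns w w≢q)) (+<+ more-earlier-w))

    burns-other : ∀ {x} → x ≢ q → x ≢ v → x ≢ w → f′ x ℤ.< + length (earlier r′ x)
    burns-other {x} x≢q x≢v x≢w = subst (ℤ._< + length (earlier r′ x)) (sym (f′-other x≢v x≢w))
      (ℤ.<-≤-trans (burns x x≢q)
        (+≤+ (length-filter-mono (below? r x) (below? r′ x) (neighbours x) (λ _ → earlier-kept x≢v))))

    burns′ : BurningOrder f′ r′
    burns′ x x≢q = by-cases (x ≟ v) (x ≟ w)
      where
      by-cases : Dec (x ≡ v) → Dec (x ≡ w) → f′ x ℤ.< + length (earlier r′ x)
      by-cases (yes x≡v) _         = subst (λ z → f′ z ℤ.< + length (earlier r′ z)) (sym x≡v) burns-v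
      by-cases (no _)    (yes x≡w) = subst (λ z → f′ z ℤ.< + length (earlier r′ z)) (sym x≡w) burns-w
      by-cases (no x≢v)  (no x≢w)  = burns-other x≢q x≢v x≢w

    f′-nonneg : ∀ x → x ≢ q → 0ℤ ℤ.≤ f′ x
    f′-nonneg x x≢q = by-cases (x ≟ v) (x ≟ w)
      where
      by-cases : Dec (x ≡ v) → Dec (x ≡ w) → 0ℤ ℤ.≤ f′ x
      by-cases (yes x≡v) _         = subst (0ℤ ℤ.≤_) (sym (trans (cong f′ x≡v) f′-v)) (+≤+ z≤n)
      by-cases (no _)    (yes x≡w) = subst (0ℤ ℤ.≤_) (sym (trans (cong f′ x≡w) f′-w))
                                       (ℤ.≤-trans (parking-nonneg P w w≢q) (ℤ.i≤suc[i] (f w)))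
      by-cases (no x≢v)  (no x≢w)  = subst (0ℤ ℤ.≤_) (sym (f′-other x≢v x≢w)) (parking-nonneg P x x≢q)

    f′-parking : IsParking G q f′
    f′-parking = burningOrder⇒parking (trans (f′-other (v≢q ∘ sym) (w≢q ∘ sym)) (proj₁ (proj₂ P))) f′-nonneg burns′

  parking-lower : ∀ {f v k} → IsParking G q f → v ≢ q → f v ≡ + suc k →
                  ∃ λ f′ → IsParking G q f′ × total f′ ≡ total f × f′ v ≡ + k
  parking-lower P v≢q fv≡1+k with parking⇒burningOrder P
  ... | r , r-inj , q-first , burns = f′ , f′-parking , total-f′ , f′-v
    where open Lowering P r-inj q-first burns v≢q fv≡1+k

  unique-max⇒nonpositive : ∀ {f} → IsMaxParking G q f → (∀ g → IsMaxParking G q g → ∀ v → g v ≡ f v) →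
                           ∀ x → x ≢ q → f x ℤ.≤ 0ℤ
  unique-max⇒nonpositive {f} (P , maximal) unique x x≢q with f x in fx≡
  ... | -[1+ _ ] = -≤+
  ... | + zero   = ℤ.≤-refl
  ... | + suc k with parking-lower P x≢q fx≡
  ... | f′ , P′ , total-f′ , f′x≡k =
    contradiction (ℤ.+-injective (trans (sym f′x≡k) (trans (unique f′ (P′ , f′-maximal) x) fx≡))) (ℕ.1+n≢n ∘ sym)
    where
    f′-maximal : ∀ g → IsParking G q g → total g ℤ.≤ total f′
    f′-maximal g Pg = subst (total g ℤ.≤_) (sym total-f′) (maximal g Pg)

  unique-max⇒unique-parking : ExactlyOne (IsMaxParking G q) → ExactlyOne (IsParking G q)
  unique-max⇒unique-parking (f , M@(P , maximal) , unique) = f , P , λ g Pg → unique g (Pg , g-maximal g Pg)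
    where
    below-parking : ∀ g → IsParking G q g → ∀ x → f x ℤ.≤ g x
    below-parking g Pg x with x ≟ q
    ... | yes refl = ℤ.≤-reflexive (trans (proj₁ (proj₂ P)) (sym (proj₁ (proj₂ Pg))))
    ... | no x≢q   = ℤ.≤-trans (unique-max⇒nonpositive M unique x x≢q) (parking-nonneg Pg x x≢q)

    g-maximal : ∀ g → IsParking G q g → ∀ h → IsParking G q h → total h ℤ.≤ total g
    g-maximal g Pg h Ph = ℤ.≤-trans (maximal h Ph) (total-mono (below-parking g Pg))

  unique-parking⇒unique-max : ExactlyOne (IsParking G q) → ExactlyOne (IsMaxParking G q)
  unique-parking⇒unique-max (f , P , unique) =
    f , (P , λ g Pg → total-mono (ℤ.≤-reflexive ∘ unique g Pg)) , λ g → unique g ∘ proj₁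

mainTheorem4 : ∀ {n : ℕ} (G : Graph n) → Connected G → (q : Fin n) →
    ExactlyOne (IsParking G q) ⇔ ExactlyOne (IsMaxParking G q)
mainTheorem4 G _ q = mk⇔ (unique-parking⇒unique-max G q) (unique-max⇒unique-parking G q)
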